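{- Let $D$ be a rooted digraph, $v\in V\setminus\{r\}$ and $S\in\mathfrak{S}_D(v)$. Then $B_{S,v,D}\in\mathsf{bubb}_D(v)$, $\mathsf{ent}_{D-rv}(B_{S,v,D})=S$, and $N^{\mathrm{in}}_{D-rv}(v)\subseteq B_{S,v,D}$.
   Context: Fix a vertex set $V$ and root $r\in V$. A digraph is a subset of $V\times V$; a rooted digraph has no edge with head $r$. $D-rv=D\setminus\{rv\}$. For $u\neq w$, a $u\to w$ path is $\{v_0v_1,\dots,v_{n-1}v_n\}$ with $v_0=u$, $v_n=w$, $v_i$ pairwise distinct; $\{v\}$ is considered a $v\to v$ path. A system of $r\to v$ paths is internally disjoint if any two distinct paths share exactly $r$ and $v$. A $v$-infan is a system of paths ending at $v$ pairwise sharing only $v$. $N^{\mathrm{in}}_H(v)$ is the set of in-neighbours of $v$ in $H$. $S\subseteq V$ separates $v$ from $r$ in $H$ if every $r\to v$ path of $H$ has a vertex in $S$. $\mathfrak{S}_D(v)$ is the set of those $S\subseteq V\setminus\{r,v\}$ that separate $v$ from $r$ in $D-rv$ and for which $D$ admits an internally disjoint system $\mathcal{P}$ of $r\to v$ paths such that $S$ consists of exactly one internal vertex chosen from each path in $\mathcal{P}$. For $X\subseteq V\setminus\{r\}$ and a digraph $H$: $\mathsf{ent}_H(X)=\{w\in X:\exists\,uw\in H,\ u\notin X\}$. $B\subseteq V\setminus\{r\}$ is a $v$-bubble w.r.t. $D$ if there is a $v$-infan $\{P_u:u\in\mathsf{ent}_D(B)\}$ in $D\cap(B\times B)$ with $P_u$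 starting at $u$; $\mathsf{bubb}_D(v)$ is the set of these. For $S\in\mathfrak{S}_D(v)$, $B_{S,v,D}$ is the set of $u\in V$ such that every $r\to u$ path in $D-rv$ meets $S$. -}

module Defs where

open import Data.Nat using (ℕ)
open import Data.Fin using (Fin)
open import Data.List using (List; head; last)
open import Data.List.Membership.Propositional using (_∈_)
open import Data.List.Relation.Unary.Linked using (Linked)
open import Data.List.Relation.Unary.Unique.Propositional using (Unique)
open import Data.Maybe using (just)
open import Data.Product using (Σ; ∃; _×_; _,_; proj₁)
open import Data.Sum using (_⊎_)
open import Relation.Nullary using (¬_)
open import Relation.Binary.PropositionalEquality using (_≡_)

Digraph : ℕ → Set₁
Digraph n = Fin n → Fin n → Set

VSet : ℕ → Set₁
VSet n = Fin n → Set

module _ {n : ℕ} where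

  _⊆_ : VSet n → VSet n → Set
  X ⊆ Y = ∀ x → X x → Y x

  Rooted : Fin n → Digraph n → Set
  Rooted r D = ∀ u → ¬ D u r

  _-edge_ : Digraph n → Fin n × Fin n → Digraph n
  (D -edge (r , v)) a b = D a b × ¬ (a ≡ r × b ≡ v)

  restrict : Digraph n → VSet n → Digraph n
  restrict H B a b = H a b × B a × B b

  -- A u → w path in H, given by its vertex sequence v₀ … vₖ (pairwise
  -- distinct, v₀ = u, vₖ = w, consecutive vertices joined by edges of H).
  -- For u = w this is exactly the trivial path {u}.
  Path : Digraph n → Fin n → Fin n → Set
  Path H u w = Σ (List (Fin n)) λ xs →
    head xs ≡ just u × last xs ≡ just w × Unique xs × Linked H xs

  _∈ᵥ_ : ∀ {H u w} → Fin n → Path H u w → Set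
  x ∈ᵥ p = x ∈ proj₁ p

  Internal : ∀ {H u w} → Fin n → Path H u w → Set
  Internal {u = u} {w = w} x p = x ∈ᵥ p × ¬ x ≡ u × ¬ x ≡ w

  Separates : Fin n → Digraph n → VSet n → Fin n → Set
  Separates r H S v = (p : Path H r v) → ∃ λ x → x ∈ᵥ p × S x

  𝔖 : Fin n → Digraph n → Fin n → VSet n → Set
  𝔖 r D v S =
      (∀ x → S x → ¬ x ≡ r × ¬ x ≡ v)
    × Separates r (D -edge (r , v)) S v
    × Σ ℕ λ k → Σ (Fin k → Path D r v) λ P →
        (∀ i j → ¬ i ≡ j → ∀ x → x ∈ᵥ P i → x ∈ᵥ P j → x ≡ r ⊎ x ≡ v)
        × Σ (Fin k → Fin n) λ c →
            (∀ i → Internal (c i) (P i))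
          × (∀ i → S (c i))
          × (∀ x → S x → ∃ λ i → c i ≡ x)

  ent : Digraph n → VSet n → VSet n
  ent H X w = X w × ∃ λ u → H u w × ¬ X u

  IsBubble : Fin n → Digraph n → Fin n → VSet n → Set
  IsBubble r D v B =
      (∀ x → B x → ¬ x ≡ r)
    × Σ ((u : Fin n) → ent D B u → Path (restrict D B) u v) λ P →
        ∀ u u' (eu : ent D B u) (eu' : ent D B u') → ¬ u ≡ u' →
          ∀ x → x ∈ᵥ P u eu → x ∈ᵥ P u' eu' → x ≡ v

  Bsv : Fin n → VSet n → Fin n → Digraph n → VSet n
  Bsv r S v D u = (p : Path (D -edge (r , v)) r u) → ∃ λ x → x ∈ᵥ p × S x

  Nin : Digraph n → Fin n → VSet n
  Nin H v u = H u v

-- Each path Pᵢ of the internally disjoint system meets S only in its chosen vertex cᵢ. Write B for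
-- B_{S,v,D}. The segment of Pᵢ from cᵢ to v lies in B: a path r → x to one of its vertices, continued
-- along the segment and loop-erased, is a path r → v of D - rv, and its only possible vertex of S
-- beyond x is cᵢ = x. Conversely B is closed backwards along every edge w → u of D - rv with u ∉ S,
-- so every entrance of B is in S (or is v), while the predecessor of cᵢ on Pᵢ lies outside B because
-- the initial segment of Pᵢ avoids S. The segments cᵢ → v form the required v-infan.
module Submission where

open import Defs
open import Data.Nat using (ℕ)
open import Data.Fin using (Fin)
open import Data.Product using (_×_; _,_)
open import Relation.Nullary using (¬_)
open import Relation.Binary.PropositionalEquality using (_≡_)

open import Data.Empty using (⊥-elim)
open import Data.Fin.Properties using (_≟_; any?)
open import Data.List using (List; []; _∷_; _++_; head; last)
open import Data.List.Membership.Propositional using (_∈_)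
open import Data.List.Membership.Propositional.Properties using (∈-∃++; ∈-++⁺ˡ; ∈-++⁺ʳ; ∈-++⁻)
import Data.List.Membership.DecPropositional as DecMembership
open import Data.List.Relation.Binary.Disjoint.Propositional using (Disjoint)
open import Data.List.Relation.Unary.All as All using ([])
import Data.List.Relation.Unary.All.Properties as Allₚ
open import Data.List.Relation.Unary.AllPairs using ([]; _∷_)
open import Data.List.Relation.Unary.Any using (here; there)
open import Data.List.Relation.Unary.Linked as Linked using (Linked; []; [-]; _∷_)
open import Data.List.Relation.Unary.Unique.Propositional using (Unique)
open import Data.Maybe using (just)
open import Data.Maybe.Properties using (just-injective)
open import Data.Product using (Σ; ∃; proj₁; proj₂)
open import Data.Sum using (_⊎_; inj₁; inj₂; [_,_]′)
open import Function using (_∘_; id)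
open import Relation.Nullary using (Dec; yes; no)
open import Relation.Binary.PropositionalEquality using (refl; sym; trans; cong; subst)

module _ {A : Set} where

  Unique-++⁻ˡ : ∀ (xs : List A) {ys} → Unique (xs ++ ys) → Unique xs
  Unique-++⁻ˡ []       _          = []
  Unique-++⁻ˡ (x ∷ xs) (x∉ ∷ xs!) = Allₚ.++⁻ˡ xs x∉ ∷ Unique-++⁻ˡ xs xs!

  Unique-++⁻ʳ : ∀ (xs : List A) {ys} → Unique (xs ++ ys) → Unique ys
  Unique-++⁻ʳ []       ys!       = ys!
  Unique-++⁻ʳ (x ∷ xs) (_ ∷ xs!) = Unique-++⁻ʳ xs xs!

  Unique-++⇒Disjoint : ∀ (xs : List A) {ys} → Unique (xs ++ ys) → Disjoint xs ys
  Unique-++⇒Disjoint (x ∷ xs) (x∉ ∷ _)  (here refl , y∈ys)  = All.lookup (Allₚ.++⁻ʳ xs x∉) y∈ys refl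
  Unique-++⇒Disjoint (x ∷ xs) (_ ∷ xs!) (there y∈xs , y∈ys) = Unique-++⇒Disjoint xs xs! (y∈xs , y∈ys)

  head-∈ : ∀ (xs : List A) {x} → head xs ≡ just x → x ∈ xs
  head-∈ (x ∷ xs) refl = here refl

  last-∈ : ∀ (xs : List A) {x} → last xs ≡ just x → x ∈ xs
  last-∈ (x ∷ [])     refl = here refl
  last-∈ (x ∷ y ∷ xs) eq   = there (last-∈ (y ∷ xs) eq)

  last-++-∷ : ∀ (xs : List A) {y ys} → last (xs ++ y ∷ ys) ≡ last (y ∷ ys)
  last-++-∷ []           = refl
  last-++-∷ (x ∷ [])     = refl
  last-++-∷ (x ∷ y ∷ xs) = last-++-∷ (y ∷ xs)

  last-++ : ∀ (xs : List A) {x ys} → last xs ≡ just x → last (xs ++ ys) ≡ last (x ∷ ys)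
  last-++ (x ∷ [])     refl = refl
  last-++ (x ∷ y ∷ xs) eq   = last-++ (y ∷ xs) eq

module _ {A : Set} {R : A → A → Set} where

  Linked-++⁻ˡ : ∀ (xs : List A) {ys} → Linked R (xs ++ ys) → Linked R xs
  Linked-++⁻ˡ []           _        = []
  Linked-++⁻ˡ (x ∷ [])     _        = [-]
  Linked-++⁻ˡ (x ∷ y ∷ xs) (r ∷ rs) = r ∷ Linked-++⁻ˡ (y ∷ xs) rs

  Linked-++⁻ʳ : ∀ (xs : List A) {ys} → Linked R (xs ++ ys) → Linked R ys
  Linked-++⁻ʳ []       rs = rs
  Linked-++⁻ʳ (x ∷ xs) rs = Linked-++⁻ʳ xs (Linked.tail rs)

  Linked-glue : ∀ (xs : List A) {x ys} → Linked R xs → last xs ≡ just x → Linked R (x ∷ ys) → Linked R (xs ++ ys)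
  Linked-glue (x ∷ [])     _        refl rs′ = rs′
  Linked-glue (x ∷ y ∷ xs) (r ∷ rs) eq   rs′ = r ∷ Linked-glue (y ∷ xs) rs eq rs′

  Linked-last-edge : ∀ x (xs : List A) {y ys} → Linked R ((x ∷ xs) ++ y ∷ ys) → ∃ λ w → last (x ∷ xs) ≡ just w × R w y
  Linked-last-edge x []       (r ∷ _)  = x , refl , r
  Linked-last-edge x (z ∷ xs) (_ ∷ rs) = Linked-last-edge z xs rs

  Linked-map∈ : ∀ {R′ : A → A → Set} {xs : List A} →
    (∀ {x y} → x ∈ xs → y ∈ xs → R x y → R′ x y) → Linked R xs → Linked R′ xs
  Linked-map∈ f []       = []
  Linked-map∈ f [-]      = [-]
  Linked-map∈ f (r ∷ rs) = f (here refl) (there (here refl)) r ∷ Linked-map∈ (λ x∈ y∈ → f (there x∈) (there y∈)) rs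

module _ {n : ℕ} {H : Digraph n} where

  trivialPath : ∀ {a} → Path H a a
  trivialPath {a} = a ∷ [] , refl , refl , [] ∷ [] , [-]

  source∈ᵥ : ∀ {a b} (p : Path H a b) → a ∈ᵥ p
  source∈ᵥ (xs , h , _) = head-∈ xs h

  target∈ᵥ : ∀ {a b} (p : Path H a b) → b ∈ᵥ p
  target∈ᵥ (xs , _ , l , _) = last-∈ xs l

  -- Keeps the vertex list, so x ∈ᵥ Path-mono p f is definitionally x ∈ᵥ p.
  Path-mono : ∀ {H′ : Digraph n} {a b} (p : Path H a b) →
    (∀ {x y} → x ∈ᵥ p → y ∈ᵥ p → H x y → H′ x y) → Path H′ a b
  Path-mono (xs , h , l , u , lk) f = xs , h , l , u , Linked-map∈ f lk

  Path-suffix : ∀ {a b x} (p : Path H a b) → x ∈ᵥ p →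
    Σ (Path H x b) λ q → (∀ {y} → y ∈ᵥ q → y ∈ᵥ p) × (a ∈ᵥ q → x ≡ a)
  Path-suffix {a} {x = x} (xs , h , l , u , lk) x∈p with ∈-∃++ x∈p
  ... | pre , sfx , refl =
    (x ∷ sfx , refl , trans (sym (last-++-∷ pre)) l , Unique-++⁻ʳ pre u , Linked-++⁻ʳ pre lk) ,
    ∈-++⁺ʳ pre , source∈suffix pre h u
    where
    source∈suffix : ∀ pre → head (pre ++ x ∷ sfx) ≡ just a → Unique (pre ++ x ∷ sfx) → a ∈ x ∷ sfx → x ≡ a
    source∈suffix []        refl _ _   = refl
    source∈suffix (a ∷ pre) refl u a∈ = ⊥-elim (Unique-++⇒Disjoint (a ∷ pre) u (here refl , a∈))

  Path-prefix : ∀ {a b x} (p : Path H a b) → x ∈ᵥ p → ¬ x ≡ a →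
    ∃ λ w → H w x × Σ (Path H a w) λ q → (∀ {y} → y ∈ᵥ q → y ∈ᵥ p) × ¬ x ∈ᵥ q × ¬ b ∈ᵥ q
  Path-prefix {x = x} (xs , h , l , u , lk) x∈p x≢a with ∈-∃++ x∈p
  ... | [] , sfx , refl = ⊥-elim (x≢a (just-injective h))
  ... | a ∷ pre , sfx , refl with h | Linked-last-edge a pre lk
  ...   | refl | w , lw , Hwx =
    w , Hwx , (a ∷ pre , refl , lw , Unique-++⁻ˡ (a ∷ pre) u , Linked-++⁻ˡ (a ∷ pre) lk) ,
    ∈-++⁺ˡ , (λ x∈q → disjoint (x∈q , here refl)) ,
    (λ b∈q → disjoint (b∈q , last-∈ (x ∷ sfx) (trans (sym (last-++-∷ (a ∷ pre))) l)))
    where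
    disjoint : Disjoint (a ∷ pre) (x ∷ sfx)
    disjoint = Unique-++⇒Disjoint (a ∷ pre) u

module _ {n : ℕ} where

  Walk : Digraph n → Fin n → Fin n → Set
  Walk H a b = Σ (List (Fin n)) λ xs → head xs ≡ just a × last xs ≡ just b × Linked H xs

  module _ {H : Digraph n} where

    open DecMembership (_≟_ {n}) using (_∈?_)

    Path⇒Walk : ∀ {a b} → Path H a b → Walk H a b
    Path⇒Walk (xs , h , l , _ , lk) = xs , h , l , lk

    edgeWalk : ∀ {a b} → H a b → Walk H a b
    edgeWalk {a} {b} e = a ∷ b ∷ [] , refl , refl , e ∷ [-]

    _++ʷ_ : ∀ {a b c} → Walk H a b → Walk H b c → Walk H a c
    (a ∷ xs , refl , l , lk) ++ʷ (b ∷ ys , refl , l′ , lk′) =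
      a ∷ xs ++ ys , refl , trans (last-++ (a ∷ xs) l) l′ , Linked-glue (a ∷ xs) lk l lk′

    ∈-++ʷ⁻ : ∀ {a b c y} (p : Walk H a b) (q : Walk H b c) → y ∈ proj₁ (p ++ʷ q) → y ∈ proj₁ p ⊎ y ∈ proj₁ q
    ∈-++ʷ⁻ (a ∷ xs , refl , _) (b ∷ ys , refl , _) y∈ with ∈-++⁻ (a ∷ xs) y∈
    ... | inj₁ y∈xs = inj₁ y∈xs
    ... | inj₂ y∈ys = inj₂ (there y∈ys)

    loopErase : ∀ a xs {b} → last (a ∷ xs) ≡ just b → Linked H (a ∷ xs) →
      Σ (Path H a b) λ p → ∀ {y} → y ∈ᵥ p → y ∈ a ∷ xs
    loopErase a []       refl _        = trivialPath , id
    loopErase a (x ∷ xs) l    (e ∷ lk) with loopErase x xs l lk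
    ... | p , p⊆ with a ∈? proj₁ p
    ...   | yes a∈p with Path-suffix p a∈p
    ...     | q , q⊆p , _ = q , there ∘ p⊆ ∘ q⊆p
    loopErase a (x ∷ xs) l (e ∷ lk)
        | (x ∷ ys , refl , l′ , u , lk′) , p⊆ | no a∉p =
      (a ∷ x ∷ ys , refl , l′ , Allₚ.¬Any⇒All¬ _ a∉p ∷ u , e ∷ lk′) ,
      λ { (here refl) → here refl ; (there y∈p) → there (p⊆ y∈p) }

    Walk⇒Path : ∀ {a b} (w : Walk H a b) → Σ (Path H a b) λ p → ∀ {y} → y ∈ᵥ p → y ∈ proj₁ w
    Walk⇒Path (a ∷ xs , refl , l , lk) = loopErase a xs l lk

module _ {n : ℕ} {r : Fin n} {H : Digraph n} {X : VSet n} where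

  Separates-backward : ∀ {x u} (w : Walk H x u) → (∀ {y} → y ∈ proj₁ w → X y → y ≡ x) →
    Separates r H X u → Separates r H X x
  Separates-backward {x} w X∩w⊆x sepᵤ p with Walk⇒Path (Path⇒Walk p ++ʷ w)
  ... | q , q⊆ with sepᵤ q
  ...   | y , y∈q , Xy with ∈-++ʷ⁻ (Path⇒Walk p) w (q⊆ y∈q)
  ...     | inj₁ y∈p = y , y∈p , Xy
  ...     | inj₂ y∈w = x , target∈ᵥ p , subst X (X∩w⊆x y∈w Xy) Xy

module Separator {n : ℕ} {r : Fin n} {D : Digraph n} {v : Fin n} {S : VSet n}
  (S-avoids : ∀ x → S x → ¬ x ≡ r × ¬ x ≡ v)
  (S-separates : Separates r (D -edge (r , v)) S v)
  {k : ℕ} (P : Fin k → Path D r v)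
  (P-disjoint : ∀ i j → ¬ i ≡ j → ∀ x → x ∈ᵥ P i → x ∈ᵥ P j → x ≡ r ⊎ x ≡ v)
  (c : Fin k → Fin n)
  (c-internal : ∀ i → Internal (c i) (P i))
  (c∈S : ∀ i → S (c i))
  (S⊆c : ∀ x → S x → ∃ λ i → c i ≡ x)
  where

  D′ : Digraph n
  D′ = D -edge (r , v)

  B : VSet n
  B = Bsv r S v D

  c∈P : ∀ i → c i ∈ᵥ P i
  c∈P i = proj₁ (c-internal i)

  c≢r : ∀ i → ¬ c i ≡ r
  c≢r i = proj₁ (proj₂ (c-internal i))

  c≢v : ∀ i → ¬ c i ≡ v
  c≢v i = proj₂ (proj₂ (c-internal i))

  S∩P⊆c : ∀ i {y} → S y → y ∈ᵥ P i → y ≡ c i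
  S∩P⊆c i {y} Sy y∈Pᵢ with S⊆c y Sy
  ... | j , refl with i ≟ j
  ...   | yes refl = refl
  ...   | no i≢j = ⊥-elim ([ c≢r j , c≢v j ]′ (P-disjoint j i (i≢j ∘ sym) (c j) (c∈P j) y∈Pᵢ))

  S? : ∀ x → Dec (S x)
  S? x with any? (λ i → c i ≟ x)
  ... | yes (i , refl) = yes (c∈S i)
  ... | no ∄i          = no (∄i ∘ S⊆c x)

  r∉B : ∀ x → B x → ¬ x ≡ r
  r∉B x Bx refl with Bx trivialPath
  ... | y , here refl , Sy = proj₁ (S-avoids y Sy) refl

  B-backward-closed : ∀ {w u} → D′ w u → B u → ¬ S u → B w
  B-backward-closed {w} {u} e Bu u∉S = Separates-backward (edgeWalk e) S∩wu⊆w Bu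
    where
    S∩wu⊆w : ∀ {y} → y ∈ w ∷ u ∷ [] → S y → y ≡ w
    S∩wu⊆w (here refl)         _  = refl
    S∩wu⊆w (there (here refl)) Sy = ⊥-elim (u∉S Sy)

  suffix : ∀ i → Σ (Path D (c i) v) λ q → (∀ {y} → y ∈ᵥ q → y ∈ᵥ P i) × (r ∈ᵥ q → c i ≡ r)
  suffix i = Path-suffix (P i) (c∈P i)

  suffix′ : ∀ i → Path D′ (c i) v
  suffix′ i = Path-mono (proj₁ (suffix i))
    (λ x∈ _ Dxy → Dxy , λ (x≡r , _) → c≢r i (proj₂ (proj₂ (suffix i)) (subst (_∈ᵥ proj₁ (suffix i)) x≡r x∈)))

  suffix′⊆P : ∀ i {y} → y ∈ᵥ suffix′ i → y ∈ᵥ P i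
  suffix′⊆P i = proj₁ (proj₂ (suffix i))

  suffix′⊆B : ∀ i {x} → x ∈ᵥ suffix′ i → B x
  suffix′⊆B i {x} x∈ with Path-suffix (suffix′ i) x∈
  ... | q , q⊆ , cᵢ∈q⇒x≡cᵢ = Separates-backward (Path⇒Walk q) S∩q⊆x S-separates
    where
    S∩q⊆x : ∀ {y} → y ∈ᵥ q → S y → y ≡ x
    S∩q⊆x y∈q Sy with S∩P⊆c i Sy (suffix′⊆P i (q⊆ y∈q))
    ... | refl = sym (cᵢ∈q⇒x≡cᵢ y∈q)

  ent⊆S : ent D′ B ⊆ S
  ent⊆S w (Bw , u , Duw , u∉B) with S? w
  ... | yes Sw  = Sw
  ... | no  w∉S = ⊥-elim (u∉B (B-backward-closed Duw Bw w∉S))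

  S⊆ent : S ⊆ ent D′ B
  S⊆ent x Sx with S⊆c x Sx
  ... | i , refl with Path-prefix (P i) (c∈P i) (c≢r i)
  ...   | w , Dwc , q , q⊆Pᵢ , cᵢ∉q , v∉q =
    suffix′⊆B i (source∈ᵥ (suffix′ i)) , w , (Dwc , c≢v i ∘ proj₂) , w∉B
    where
    q′ : Path D′ r w
    q′ = Path-mono q (λ _ y∈q Dxy → Dxy , λ (_ , y≡v) → v∉q (subst (_∈ᵥ q) y≡v y∈q))
    w∉B : ¬ B w
    w∉B Bw with Bw q′
    ... | y , y∈q , Sy = cᵢ∉q (subst (_∈ᵥ q) (S∩P⊆c i Sy (q⊆Pᵢ y∈q)) y∈q)

  Nin⊆B : Nin D′ v ⊆ B
  Nin⊆B u Duv = B-backward-closed Duv S-separates (λ Sv → proj₂ (S-avoids v Sv) refl)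

  Entrance : Fin n → Set
  Entrance u = u ≡ v ⊎ ∃ λ i → c i ≡ u

  ent⇒Entrance : ∀ u → ent D B u → Entrance u
  ent⇒Entrance u (Bu , w , Dwu , w∉B) with u ≟ v
  ... | yes u≡v = inj₁ u≡v
  ... | no  u≢v = inj₂ (S⊆c u (ent⊆S u (Bu , w , (Dwu , u≢v ∘ proj₂) , w∉B)))

  entrancePath : ∀ {u} → Entrance u → Path (restrict D B) u v
  entrancePath (inj₁ refl)       = trivialPath
  entrancePath (inj₂ (i , refl)) =
    Path-mono (suffix′ i) (λ x∈ y∈ D′xy → proj₁ D′xy , suffix′⊆B i x∈ , suffix′⊆B i y∈)

  entrancePaths-disjoint : ∀ {u u′} (eu : Entrance u) (eu′ : Entrance u′) → ¬ u ≡ u′ →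
    ∀ {x} → x ∈ᵥ entrancePath eu → x ∈ᵥ entrancePath eu′ → x ≡ v
  entrancePaths-disjoint (inj₁ refl) _           _ (here refl) _           = refl
  entrancePaths-disjoint (inj₂ _)    (inj₁ refl) _ _           (here refl) = refl
  entrancePaths-disjoint (inj₂ (i , refl)) (inj₂ (j , refl)) cᵢ≢cⱼ {x} x∈ x∈′
    with P-disjoint i j (cᵢ≢cⱼ ∘ cong c) x (suffix′⊆P i x∈) (suffix′⊆P j x∈′)
  ... | inj₁ refl = ⊥-elim (r∉B r (suffix′⊆B i x∈) refl)
  ... | inj₂ x≡v  = x≡v

  B-isBubble : IsBubble r D v B
  B-isBubble = r∉B , (λ u eu → entrancePath (ent⇒Entrance u eu)) ,
    λ u u′ eu eu′ u≢u′ _ → entrancePaths-disjoint (ent⇒Entrance u eu) (ent⇒Entrance u′ eu′) u≢u′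

proposition3p8 : {n : ℕ} (r : Fin n) (D : Digraph n) (v : Fin n) (S : VSet n) →
    Rooted r D → ¬ v ≡ r → 𝔖 r D v S →
    IsBubble r D v (Bsv r S v D)
      × (ent (D -edge (r , v)) (Bsv r S v D) ⊆ S × S ⊆ ent (D -edge (r , v)) (Bsv r S v D))
      × (Nin (D -edge (r , v)) v ⊆ Bsv r S v D)
proposition3p8 r D v S _ _ (S-avoids , S-separates , _ , P , P-disjoint , c , c-internal , c∈S , S⊆c) =
  B-isBubble , (ent⊆S , S⊆ent) , Nin⊆B
  where open Separator S-avoids S-separates P P-disjoint c c-internal c∈S S⊆c
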